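{- Every split graph $G$ with minimum degree $\delta(G)\ge 2$ is not IRC-colorable.
   Context: All graphs are finite, simple, undirected and connected. Split graphs. A split graph is a graph whose vertex set can be partitioned into a clique and an independent set. Private neighbors. For $S\subseteq V(G)$ and $v\in S$, $pn[v,S]=N[v]\setminus\bigcup_{u\in S\setminus\{v\}}N[u]$, where $N[\cdot]$ is the closed neighborhood. $S$ is irredundant if $pn[v,S]\ne\emptyset$ for all $v\in S$. Rainbow committees and IRC-colorings. For a proper coloring of $G$ with nonempty color classes $V_1,\dots,V_k$, a rainbow committee is a set containing exactly one vertex of each color class. An irredundance compelling coloring (IRC-coloring) is a proper coloring in which every rainbow committee is an irredundant set. $G$ is IRC-colorable if it admits an IRC-coloring. -}

module Defs where

open import Data.Nat using (ℕ; _≤_)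
open import Data.Bool using (Bool; T)
open import Data.Fin using (Fin)
open import Data.Fin.Subset using (Subset; _∈_; _∉_; ∣_∣)
open import Data.Vec using (tabulate)
open import Data.Product using (Σ; ∃; _×_)
open import Relation.Nullary using (¬_)
open import Relation.Binary.PropositionalEquality using (_≡_; _≢_)
open import Data.Sum using (_⊎_)

record Graph (n : ℕ) : Set where
  field
    adj    : Fin n → Fin n → Bool
    sym    : ∀ u v → adj u v ≡ adj v u
    irrefl : ∀ v → adj v v ≡ Data.Bool.false

module _ {n : ℕ} (G : Graph n) where
  open Graph G

  Adj : Fin n → Fin n → Set
  Adj u v = T (adj u v)

  data Reach (u : Fin n) : Fin n → Set where
    here : Reach u u
    step : ∀ {v w} → Reach u v → Adj v w → Reach u w

  Connected : Set
  Connected = ∀ u v → Reach u v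

  nbhd : Fin n → Subset n
  nbhd v = tabulate (adj v)

  degree : Fin n → ℕ
  degree v = ∣ nbhd v ∣

  MinDegree≥ : ℕ → Set
  MinDegree≥ d = ∀ v → d ≤ degree v

  IsClique : Subset n → Set
  IsClique K = ∀ u v → u ∈ K → v ∈ K → u ≢ v → Adj u v

  IsIndependent : Subset n → Set
  IsIndependent I = ∀ u v → u ∈ I → v ∈ I → ¬ Adj u v

  IsSplit : Set
  IsSplit = Σ (Subset n) λ K → Σ (Subset n) λ I →
              (∀ v → (v ∈ K × v ∉ I) ⊎ (v ∉ K × v ∈ I))
              × IsClique K × IsIndependent I

  InN[_] : Fin n → Fin n → Set
  InN[ v ] w = (w ≡ v) ⊎ Adj v w

  Irredundant : Subset n → Set
  Irredundant S = ∀ v → v ∈ S →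
    ∃ λ w → InN[ v ] w × (∀ u → u ∈ S → u ≢ v → ¬ InN[ u ] w)

  IsProperColoring : (k : ℕ) → (Fin n → Fin k) → Set
  IsProperColoring k c = (∀ u v → Adj u v → c u ≢ c v) × (∀ i → ∃ λ v → c v ≡ i)

  IsRainbowCommittee : (k : ℕ) → (Fin n → Fin k) → Subset n → Set
  IsRainbowCommittee k c S =
    ∀ i → ∃ λ v → v ∈ S × c v ≡ i × (∀ u → u ∈ S → c u ≡ i → u ≡ v)

  IsIRCColoring : (k : ℕ) → (Fin n → Fin k) → Set
  IsIRCColoring k c = IsProperColoring k c ×
    (∀ S → IsRainbowCommittee k c S → Irredundant S)

  IRCColorable : Set
  IRCColorable = ∃ λ k → ∃ λ (c : Fin n → Fin k) → IsIRCColoring k c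

{-# OPTIONS --safe #-}
module Submission where

-- If x and a are adjacent and N[x] ⊆ N[a], no colouring is an IRC-colouring: x and a get
-- different colours, so some rainbow committee contains both, and then x has no private
-- neighbour. In a split graph, a vertex x on the independent side (any vertex, if that side is
-- empty) has all its neighbours in the clique, so N[x] ⊆ N[a] for any neighbour a of x.

open import Defs
open import Data.Nat using (ℕ; _≤_; s≤s; z≤n)
open import Data.Nat.Properties using (≤-trans)
open import Data.Bool using (Bool; T)
open import Data.Bool.Properties using (T-≡)
open import Data.Fin using (Fin; zero; suc; fromℕ<; _≟_)
open import Data.Fin.Properties using (any?)
open import Data.Fin.Subset using (Subset; _∈_; _∉_; ∣_∣; Nonempty; inside; outside)
open import Data.Fin.Subset.Properties using (_∈?_)
open import Data.Vec using (_∷_; tabulate; here; there)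
open import Data.Vec.Properties using ([]=⇒lookup; lookup⇒[]=; lookup∘tabulate)
open import Data.Product using (∃; _×_; _,_; proj₁; proj₂)
open import Data.Sum using (_⊎_; inj₁; inj₂)
open import Data.Empty using (⊥-elim)
open import Function using (_∘_)
open import Function.Bundles using (Equivalence)
open import Relation.Nullary using (¬_; yes; no)
open import Relation.Nullary.Decidable using (⌊_⌋; toWitness; fromWitness)
open import Relation.Binary.PropositionalEquality using (_≡_; _≢_; refl; sym; trans; cong)

nonempty-if-∣∣≥1 : ∀ {m} (p : Subset m) → 1 ≤ ∣ p ∣ → Nonempty p
nonempty-if-∣∣≥1 (inside  ∷ p) _  = zero , here
nonempty-if-∣∣≥1 (outside ∷ p) ∣p∣≥1 with nonempty-if-∣∣≥1 p ∣p∣≥1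
... | v , v∈p = suc v , there v∈p

∈-tabulate⁺ : ∀ {m} {f : Fin m → Bool} {v} → T (f v) → v ∈ tabulate f
∈-tabulate⁺ {f = f} {v} fv =
  lookup⇒[]= v (tabulate f) (trans (lookup∘tabulate f v) (Equivalence.to T-≡ fv))

∈-tabulate⁻ : ∀ {m} {f : Fin m → Bool} {v} → v ∈ tabulate f → T (f v)
∈-tabulate⁻ {f = f} {v} v∈ =
  Equivalence.from T-≡ (trans (sym (lookup∘tabulate f v)) ([]=⇒lookup v∈))

∉I⇒∈K : ∀ {m} (K I : Subset m) → (∀ v → (v ∈ K × v ∉ I) ⊎ (v ∉ K × v ∈ I)) →
  ∀ {v} → v ∉ I → v ∈ K
∉I⇒∈K _ _ partition {v} v∉I with partition v
... | inj₁ (v∈K , _) = v∈K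
... | inj₂ (_ , v∈I) = ⊥-elim (v∉I v∈I)

module _ {n : ℕ} (G : Graph n) where
  open Graph G renaming (sym to adj-sym)

  Adj-sym : ∀ {u v} → Adj G u v → Adj G v u
  Adj-sym {u} {v} uv = Equivalence.from T-≡ (trans (adj-sym v u) (Equivalence.to T-≡ uv))

  Adj⇒≢ : ∀ {u v} → Adj G u v → u ≢ v
  Adj⇒≢ {u} uu refl with trans (sym (irrefl u)) (Equivalence.to T-≡ uu)
  ... | ()

  degree≥1⇒neighbour : ∀ v → 1 ≤ degree G v → ∃ (Adj G v)
  degree≥1⇒neighbour v deg≥1 with nonempty-if-∣∣≥1 (nbhd G v) deg≥1
  ... | u , u∈N = u , ∈-tabulate⁻ u∈N

  N[_]⊆N[_] : Fin n → Fin n → Set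
  N[ x ]⊆N[ a ] = ∀ w → InN[_] G x w → InN[_] G a w

  ¬Irredundant-if-N⊆N : ∀ {S x a} → x ∈ S → a ∈ S → x ≢ a → N[ x ]⊆N[ a ] →
    ¬ Irredundant G S
  ¬Irredundant-if-N⊆N {x = x} x∈S a∈S x≢a x⊆a irr with irr x x∈S
  ... | w , w∈N[x] , private-w = private-w _ a∈S (x≢a ∘ sym) (x⊆a w w∈N[x])

  module Committees {k : ℕ} (c : Fin n → Fin k) where

    Section : (Fin k → Fin n) → Set
    Section r = ∀ i → c (r i) ≡ i

    redirect : (Fin k → Fin n) → Fin n → Fin k → Fin n
    redirect r v i with i ≟ c v
    ... | yes _ = v
    ... | no  _ = r i

    redirect-section : ∀ {r} v → Section r → Section (redirect r v)
    redirect-section v s i with i ≟ c v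
    ... | yes i≡cv = sym i≡cv
    ... | no  _    = s i

    redirect-here : ∀ r v → redirect r v (c v) ≡ v
    redirect-here r v with c v ≟ c v
    ... | yes _ = refl
    ... | no cv≢cv = ⊥-elim (cv≢cv refl)

    redirect-elsewhere : ∀ r v {i} → i ≢ c v → redirect r v i ≡ r i
    redirect-elsewhere r v {i} i≢cv with i ≟ c v
    ... | yes i≡cv = ⊥-elim (i≢cv i≡cv)
    ... | no  _    = refl

    committee : (Fin k → Fin n) → Subset n
    committee r = tabulate λ v → ⌊ v ≟ r (c v) ⌋

    ∈-committee⁺ : ∀ r {v} → v ≡ r (c v) → v ∈ committee r
    ∈-committee⁺ _ = ∈-tabulate⁺ ∘ fromWitness

    ∈-committee⁻ : ∀ r {v} → v ∈ committee r → v ≡ r (c v)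
    ∈-committee⁻ _ = toWitness ∘ ∈-tabulate⁻

    committee-rainbow : ∀ {r} → Section r → IsRainbowCommittee G k c (committee r)
    committee-rainbow {r} s i =
      r i , ∈-committee⁺ r (sym (cong r (s i))) , s i ,
      λ u u∈ cu≡i → trans (∈-committee⁻ r u∈) (cong r cu≡i)

    rainbowCommittee-through : (∀ i → ∃ λ v → c v ≡ i) → ∀ {x a} → c x ≢ c a →
      ∃ λ S → IsRainbowCommittee G k c S × x ∈ S × a ∈ S
    rainbowCommittee-through onto {x} {a} cx≢ca =
      committee r , committee-rainbow r-section ,
      ∈-committee⁺ r (sym (redirect-here _ x)) ,
      ∈-committee⁺ r (sym (trans (redirect-elsewhere _ x (cx≢ca ∘ sym)) (redirect-here _ a)))
      where
      r : Fin k → Fin n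
      r = redirect (redirect (proj₁ ∘ onto) a) x
      r-section : Section r
      r-section = redirect-section x (redirect-section a (proj₂ ∘ onto))

  ¬IRCColorable-if-N⊆N : ∀ {x a} → Adj G x a → N[ x ]⊆N[ a ] → ¬ IRCColorable G
  ¬IRCColorable-if-N⊆N xa x⊆a (k , c , (proper , onto) , irc)
    with Committees.rainbowCommittee-through c onto (proper _ _ xa)
  ... | S , rainbow , x∈S , a∈S = ¬Irredundant-if-N⊆N x∈S a∈S (Adj⇒≢ xa) x⊆a (irc S rainbow)

  N⊆N-if-neighbours-in-clique : ∀ {K x a} → IsClique G K → (∀ w → Adj G x w → w ∈ K) →
    Adj G x a → N[ x ]⊆N[ a ]
  N⊆N-if-neighbours-in-clique _ _ xa w (inj₁ refl) = inj₂ (Adj-sym xa)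
  N⊆N-if-neighbours-in-clique {a = a} clique N[x]⊆K xa w (inj₂ xw) with w ≟ a
  ... | yes w≡a = inj₁ w≡a
  ... | no  w≢a = inj₂ (clique a w (N[x]⊆K a xa) (N[x]⊆K w xw) (w≢a ∘ sym))

  split⇒vertex-with-neighbours-in-clique : IsSplit G → Fin n →
    ∃ λ x → ∃ λ K → IsClique G K × (∀ w → Adj G x w → w ∈ K)
  split⇒vertex-with-neighbours-in-clique (K , I , partition , clique , independent) v
    with any? (_∈? I)
  ... | yes (x , x∈I) = x , K , clique , λ w xw →
                          ∉I⇒∈K K I partition (λ w∈I → independent x w x∈I w∈I xw)
  ... | no  I-empty   = v , K , clique , λ w _ → ∉I⇒∈K K I partition (λ w∈I → I-empty (w , w∈I))

corollary5 : ∀ (n : ℕ) (G : Graph n) → 1 ≤ n → Connected G → IsSplit G →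
    MinDegree≥ G 2 → ¬ IRCColorable G
corollary5 n G n≥1 _ split δ≥2
  with split⇒vertex-with-neighbours-in-clique G split (fromℕ< n≥1)
... | x , K , clique , N[x]⊆K with degree≥1⇒neighbour G x (≤-trans (s≤s z≤n) (δ≥2 x))
... | a , xa = ¬IRCColorable-if-N⊆N G xa (N⊆N-if-neighbours-in-clique G clique N[x]⊆K xa)
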